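{- $\gamma_{MB}(P_3 \square P_4) = 5$ and $\gamma'_{MB}(P_3 \square P_4) = 6$.
   Context: The Maker-Breaker domination game on a finite graph $G$ is played by Dominator and Staller, who alternately claim a previously unplayed vertex of $G$. Dominator wins as soon as his claimed vertices form a dominating set of $G$; Staller wins if she claims all vertices of some closed neighborhood $N_G[v]$. The D-game is the game where Dominator moves first, the S-game where Staller moves first. $\gamma_{MB}(G)$ (resp. $\gamma'_{MB}(G)$) is the minimum number of moves Dominator needs to win the D-game (resp. S-game) when both players play optimally (Dominator trying to win as fast as possible, Staller trying to delay this), and is $\infty$ if Dominator has no winning strategy in that game. $P_k$ is the path on $k$ vertices and $\square$ denotes the Cartesian product of graphs. -}

module Defs where

open import Data.Nat using (ℕ; zero; suc; _*_; _+_; _<_)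
open import Data.Fin using (Fin; toℕ; remQuot)
open import Data.Fin.Subset using (Subset; _∈_; _∉_; _∪_; ⁅_⁆; ⊥)
open import Data.Product using (Σ; ∃; _×_; _,_; proj₁; proj₂)
open import Data.Sum using (_⊎_)
open import Relation.Nullary using (¬_)
open import Relation.Binary.PropositionalEquality using (_≡_)

record Graph (n : ℕ) : Set₁ where
  field
    Adj : Fin n → Fin n → Set

open Graph public

InClosedNbhd : ∀ {n} → Graph n → Fin n → Fin n → Set
InClosedNbhd G v u = u ≡ v ⊎ Adj G v u

Dominating : ∀ {n} → Graph n → Subset n → Set
Dominating G D = ∀ v → ∃ λ u → u ∈ D × InClosedNbhd G v u

ClaimsClosedNbhd : ∀ {n} → Graph n → Subset n → Set
ClaimsClosedNbhd G S = ∃ λ v → ∀ u → InClosedNbhd G v u → u ∈ S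

-- Position: D = Dominator's vertices, S = Staller's vertices.
-- DTurn G k D S : Dominator is to move and can force a win using at most k
--   (further) moves of his own.
-- STurn G k D S : Staller is to move and Dominator can force a win using at
--   most k (further) moves of his own.
mutual
  data DTurn {n} (G : Graph n) : ℕ → Subset n → Subset n → Set where
    dmove : ∀ {k D S} (u : Fin n) → u ∉ D → u ∉ S →
            (Dominating G (D ∪ ⁅ u ⁆) ⊎ STurn G k (D ∪ ⁅ u ⁆) S) →
            DTurn G (suc k) D S

  data STurn {n} (G : Graph n) : ℕ → Subset n → Subset n → Set where
    smoves : ∀ {k D S} →
             (∀ (v : Fin n) → v ∉ D → v ∉ S →
                 (¬ ClaimsClosedNbhd G (S ∪ ⁅ v ⁆)) × DTurn G k D (S ∪ ⁅ v ⁆)) →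
             STurn G k D S

DGameWithin : ∀ {n} → Graph n → ℕ → Set
DGameWithin G k = DTurn G k ⊥ ⊥

SGameWithin : ∀ {n} → Graph n → ℕ → Set
SGameWithin G k = STurn G k ⊥ ⊥

γMB≡ : ∀ {n} → Graph n → ℕ → Set
γMB≡ G k = DGameWithin G k × (∀ j → j < k → ¬ DGameWithin G j)

γ'MB≡ : ∀ {n} → Graph n → ℕ → Set
γ'MB≡ G k = SGameWithin G k × (∀ j → j < k → ¬ SGameWithin G j)

PathAdj : ∀ {k} → Fin k → Fin k → Set
PathAdj i j = suc (toℕ i) ≡ toℕ j ⊎ suc (toℕ j) ≡ toℕ i

GridAdj : ∀ m k → Fin (m * k) → Fin (m * k) → Set
GridAdj m k x y =
  (proj₁ (remQuot {m} k x) ≡ proj₁ (remQuot {m} k y) × PathAdj (proj₂ (remQuot {m} k x)) (proj₂ (remQuot {m} k y)))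
  ⊎ (proj₂ (remQuot {m} k x) ≡ proj₂ (remQuot {m} k y) × PathAdj (proj₁ (remQuot {m} k x)) (proj₁ (remQuot {m} k y)))

Grid : ∀ m k → Graph (m * k)
Grid m k = record { Adj = GridAdj m k }

{-# OPTIONS --safe #-}
module Submission where

-- Each value is witnessed by explicit strategies checked against every opposing move: Dominator
-- strategies winning the D-game within 5 and the S-game within 6 moves, and Staller strategies
-- preventing a Dominator win within 4 and within 5 moves respectively. Smaller budgets need no
-- separate refutation, since a win within j moves is also a win within any k ≥ j.

open import Defs
open import Data.Bool using (if_then_else_)
open import Data.Empty using (⊥-elim)
open import Data.Fin using (Fin; zero; suc; toℕ; remQuot)
import Data.Fin.Properties as Fin
open import Data.Fin.Properties using (any?; all?)
open import Data.Fin.Subset using (Subset; _∈_; _∉_; _∪_; _∩_; ⁅_⁆; ⊥; Nonempty; inside; outside)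
open import Data.Fin.Subset.Properties using (_∈?_; _⊆?_; nonempty?; x∈p∩q⁺; x∈p∩q⁻)
open import Data.Maybe using (Maybe; just; nothing)
open import Data.Nat using (ℕ; zero; suc; _≤′_; ≤′-refl; ≤′-step; s≤s⁻¹; NonZero)
import Data.Nat as ℕ
open import Data.Nat.DivMod using (_/_; _mod_)
open import Data.Nat.Properties using (≤⇒≤′)
open import Data.Product using (_×_; _,_; ∃; proj₁; proj₂)
open import Data.Sum using (_⊎_; inj₁; inj₂)
import Data.Sum as Sum
open import Data.Vec using (Vec; _∷_; []; lookup)
open import Function using (_∘_)
open import Function.Bundles using (_⇔_; mk⇔)
open Function.Bundles.Equivalence using (to; from)
open import Relation.Binary.PropositionalEquality using (_≡_; refl)
open import Relation.Nullary using (¬_; Dec; yes; no; does; contradiction)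
open import Relation.Nullary.Decidable using (_×-dec_; _⊎-dec_; _→-dec_; ¬?; map′; from-yes)

module _ {n} (G : Graph n) where

  mutual
    DTurn-suc : ∀ {k D S} → DTurn G k D S → DTurn G (suc k) D S
    DTurn-suc (dmove u u∉D u∉S (inj₁ dom)) = dmove u u∉D u∉S (inj₁ dom)
    DTurn-suc (dmove u u∉D u∉S (inj₂ win)) = dmove u u∉D u∉S (inj₂ (STurn-suc win))

    STurn-suc : ∀ {k D S} → STurn G k D S → STurn G (suc k) D S
    STurn-suc (smoves win) = smoves λ v v∉D v∉S →
      let ¬claims , next = win v v∉D v∉S in ¬claims , DTurn-suc next

  DTurn-mono : ∀ {j k D S} → j ≤′ k → DTurn G j D S → DTurn G k D S
  DTurn-mono ≤′-refl        win = win
  DTurn-mono (≤′-step j≤′k) win = DTurn-suc (DTurn-mono j≤′k win)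

  STurn-mono : ∀ {j k D S} → j ≤′ k → STurn G j D S → STurn G k D S
  STurn-mono ≤′-refl        win = win
  STurn-mono (≤′-step j≤′k) win = STurn-suc (STurn-mono j≤′k win)

  γMB≡-intro : ∀ {k} → DGameWithin G (suc k) → ¬ DGameWithin G k → γMB≡ G (suc k)
  γMB≡-intro win ¬win = win , λ j j<1+k → ¬win ∘ DTurn-mono (≤⇒≤′ (s≤s⁻¹ j<1+k))

  γ'MB≡-intro : ∀ {k} → SGameWithin G (suc k) → ¬ SGameWithin G k → γ'MB≡ G (suc k)
  γ'MB≡-intro win ¬win = win , λ j j<1+k → ¬win ∘ STurn-mono (≤⇒≤′ (s≤s⁻¹ j<1+k))

-- A check consumes a prefix of its certificate and returns the rest, or rejects.
Check : Set
Check = ℕ → Maybe ℕ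

data Passes (m : Check) : Set where
  passes : ∀ c {c′} → m c ≡ just c′ → Passes m

pass : Check
pass = just

fail : Check
fail _ = nothing

require : ∀ {P : Set} → Dec P → Check
require P? = if does P? then pass else fail

when : ∀ {P : Set} → Dec P → Check → Check
when P? m = if does P? then m else pass

unless : ∀ {P : Set} → Dec P → Check → Check
unless P? m = if does P? then pass else m

infixr 1 _>>_

_>>_ : Check → Check → Check
(m >> m′) c with m c
... | nothing = nothing
... | just c′ = m′ c′

all-pass : ∀ {m} → (Fin m → Check) → Check
all-pass {zero}  f = pass
all-pass {suc m} f = f zero >> all-pass (f ∘ suc)

-- Choices are read from the certificate as its base-n digits, least significant first.
withDigit : ∀ {n} .{{_ : NonZero n}} → (Fin n → Check) → Check
withDigit {n} f c = f (c mod n) (c / n)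

fail-sound : ¬ Passes fail
fail-sound (passes _ ())

require-sound : ∀ {P} (P? : Dec P) → Passes (require P?) → P
require-sound (yes p) _ = p
require-sound (no _)  (passes _ ())

when-sound : ∀ {P} (P? : Dec P) {m} → Passes (when P? m) → P → Passes m
when-sound (yes _) passed _ = passed
when-sound (no ¬p) _      p = contradiction p ¬p

unless-sound : ∀ {P} (P? : Dec P) {m} → Passes (unless P? m) → P ⊎ Passes m
unless-sound (yes p) _      = inj₁ p
unless-sound (no _)  passed = inj₂ passed

>>-sound : ∀ m m′ → Passes (m >> m′) → Passes m × Passes m′
>>-sound m m′ (passes c h) with m c in eq
... | just c′ = passes c eq , passes c′ h

all-pass-sound : ∀ {m} (f : Fin m → Check) → Passes (all-pass f) → ∀ i → Passes (f i)
all-pass-sound f passed zero    = proj₁ (>>-sound (f zero) _ passed)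
all-pass-sound f passed (suc i) = all-pass-sound (f ∘ suc) (proj₂ (>>-sound (f zero) _ passed)) i

withDigit-sound : ∀ {n} .{{_ : NonZero n}} (f : Fin n → Check) →
                  Passes (withDigit f) → ∃ λ u → Passes (f u)
withDigit-sound {n} f (passes c h) = c mod n , passes (c / n) h

module StrategyCheck {n} .{{_ : NonZero n}} (G : Graph n) (N : Fin n → Subset n)
                     (N-correct : ∀ v u → u ∈ N v ⇔ InClosedNbhd G v u) where

  meets⇒dominating : ∀ {D} → (∀ v → Nonempty (N v ∩ D)) → Dominating G D
  meets⇒dominating {D} meets v =
    let u , u∈N[v]∩D = meets v ; u∈N[v] , u∈D = x∈p∩q⁻ (N v) D u∈N[v]∩D
    in u , u∈D , to (N-correct v u) u∈N[v]

  dominating⇒meets : ∀ {D} → Dominating G D → ∀ v → Nonempty (N v ∩ D)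
  dominating⇒meets dom v = let u , u∈D , vu = dom v in u , x∈p∩q⁺ (from (N-correct v u) vu , u∈D)

  dominating? : ∀ D → Dec (Dominating G D)
  dominating? D = map′ meets⇒dominating dominating⇒meets (all? λ v → nonempty? (N v ∩ D))

  claimsClosedNbhd? : ∀ S → Dec (ClaimsClosedNbhd G S)
  claimsClosedNbhd? S =
    map′ (λ (v , N[v]⊆S) → v , λ u vu → N[v]⊆S (from (N-correct v u) vu))
         (λ (v , claims) → v , λ {u} u∈N[v] → claims u (to (N-correct v u) u∈N[v]))
         (any? λ v → N v ⊆? S)

  unclaimed? : ∀ (D S : Subset n) u → Dec (u ∉ D × u ∉ S)
  unclaimed? D S u = ¬? (u ∈? D) ×-dec ¬? (u ∈? S)

  -- Certificates for DTurn and STurn list Dominator's moves, those for their negations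
  -- Staller's moves, in depth-first order of the game tree with the opponent's moves
  -- enumerated in increasing order.
  mutual
    checkDTurn : ℕ → Subset n → Subset n → Check
    checkDTurn zero    D S = fail
    checkDTurn (suc k) D S = withDigit (checkDominatorMove k D S)

    checkDominatorMove : ℕ → Subset n → Subset n → Fin n → Check
    checkDominatorMove k D S u =
      require (unclaimed? D S u) >> unless (dominating? (D ∪ ⁅ u ⁆)) (checkSTurn k (D ∪ ⁅ u ⁆) S)

    checkSTurn : ℕ → Subset n → Subset n → Check
    checkSTurn k D S = all-pass (checkStallerMove k D S)

    checkStallerMove : ℕ → Subset n → Subset n → Fin n → Check
    checkStallerMove k D S v = when (unclaimed? D S v)
      (require (¬? (claimsClosedNbhd? (S ∪ ⁅ v ⁆))) >> checkDTurn k D (S ∪ ⁅ v ⁆))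

  mutual
    checkDTurn-sound : ∀ k D S → Passes (checkDTurn k D S) → DTurn G k D S
    checkDTurn-sound zero    D S = ⊥-elim ∘ fail-sound
    checkDTurn-sound (suc k) D S passed =
      let u , passed-u    = withDigit-sound (checkDominatorMove k D S) passed
          free , continue = >>-sound (require (unclaimed? D S u)) _ passed-u
          u∉D , u∉S       = require-sound (unclaimed? D S u) free
      in dmove u u∉D u∉S (Sum.map₂ (checkSTurn-sound k (D ∪ ⁅ u ⁆) S)
                                   (unless-sound (dominating? (D ∪ ⁅ u ⁆)) continue))

    checkSTurn-sound : ∀ k D S → Passes (checkSTurn k D S) → STurn G k D S
    checkSTurn-sound k D S passed = smoves λ v v∉D v∉S →
      let ¬claims? = ¬? (claimsClosedNbhd? (S ∪ ⁅ v ⁆))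
          passed-v = all-pass-sound (checkStallerMove k D S) passed v
          ¬claims , continue =
            >>-sound (require ¬claims?) _ (when-sound (unclaimed? D S v) passed-v (v∉D , v∉S))
      in require-sound ¬claims? ¬claims , checkDTurn-sound k D (S ∪ ⁅ v ⁆) continue

  mutual
    check¬DTurn : ℕ → Subset n → Subset n → Check
    check¬DTurn zero    D S = pass
    check¬DTurn (suc k) D S = all-pass (check¬DominatorMove k D S)

    check¬DominatorMove : ℕ → Subset n → Subset n → Fin n → Check
    check¬DominatorMove k D S u = when (unclaimed? D S u)
      (require (¬? (dominating? (D ∪ ⁅ u ⁆))) >> check¬STurn k (D ∪ ⁅ u ⁆) S)

    check¬STurn : ℕ → Subset n → Subset n → Check
    check¬STurn k D S = withDigit (check¬StallerMove k D S)

    check¬StallerMove : ℕ → Subset n → Subset n → Fin n → Check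
    check¬StallerMove k D S v =
      require (unclaimed? D S v) >> unless (claimsClosedNbhd? (S ∪ ⁅ v ⁆)) (check¬DTurn k D (S ∪ ⁅ v ⁆))

  mutual
    check¬DTurn-sound : ∀ k D S → Passes (check¬DTurn k D S) → ¬ DTurn G k D S
    check¬DTurn-sound zero    D S _ ()
    check¬DTurn-sound (suc k) D S passed (dmove u u∉D u∉S win) =
      let ¬dom? = ¬? (dominating? (D ∪ ⁅ u ⁆))
          passed-u = all-pass-sound (check¬DominatorMove k D S) passed u
          ¬dom , continue =
            >>-sound (require ¬dom?) _ (when-sound (unclaimed? D S u) passed-u (u∉D , u∉S))
      in Sum.[ require-sound ¬dom? ¬dom , check¬STurn-sound k (D ∪ ⁅ u ⁆) S continue ] win

    check¬STurn-sound : ∀ k D S → Passes (check¬STurn k D S) → ¬ STurn G k D S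
    check¬STurn-sound k D S passed (smoves win) =
      let v , passed-v    = withDigit-sound (check¬StallerMove k D S) passed
          free , continue = >>-sound (require (unclaimed? D S v)) _ passed-v
          v∉D , v∉S       = require-sound (unclaimed? D S v) free
          ¬claims , next  = win v v∉D v∉S
      in Sum.[ ¬claims , (λ passed′ → check¬DTurn-sound k D (S ∪ ⁅ v ⁆) passed′ next) ]
           (unless-sound (claimsClosedNbhd? (S ∪ ⁅ v ⁆)) continue)

pathAdj? : ∀ {k} (i j : Fin k) → Dec (PathAdj i j)
pathAdj? i j = (suc (toℕ i) ℕ.≟ toℕ j) ⊎-dec (suc (toℕ j) ℕ.≟ toℕ i)

gridAdj? : ∀ m k x y → Dec (GridAdj m k x y)
gridAdj? m k x y = ((i Fin.≟ i′) ×-dec pathAdj? j j′) ⊎-dec ((j Fin.≟ j′) ×-dec pathAdj? i i′)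
  where
  i  = proj₁ (remQuot {m} k x)
  j  = proj₂ (remQuot {m} k x)
  i′ = proj₁ (remQuot {m} k y)
  j′ = proj₂ (remQuot {m} k y)

gridClosedNbhd? : ∀ m k v u → Dec (InClosedNbhd (Grid m k) v u)
gridClosedNbhd? m k v u = (u Fin.≟ v) ⊎-dec gridAdj? m k v u

-- Listed explicitly because a computed table would be recomputed at every lookup.
gridClosedNbhds : Vec (Subset 12) 12
gridClosedNbhds =
  (inside ∷ inside ∷ outside ∷ outside ∷ inside ∷ outside ∷ outside ∷ outside ∷ outside ∷ outside ∷ outside ∷ outside ∷ [])
  ∷ (inside ∷ inside ∷ inside ∷ outside ∷ outside ∷ inside ∷ outside ∷ outside ∷ outside ∷ outside ∷ outside ∷ outside ∷ [])
  ∷ (outside ∷ inside ∷ inside ∷ inside ∷ outside ∷ outside ∷ inside ∷ outside ∷ outside ∷ outside ∷ outside ∷ outside ∷ [])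
  ∷ (outside ∷ outside ∷ inside ∷ inside ∷ outside ∷ outside ∷ outside ∷ inside ∷ outside ∷ outside ∷ outside ∷ outside ∷ [])
  ∷ (inside ∷ outside ∷ outside ∷ outside ∷ inside ∷ inside ∷ outside ∷ outside ∷ inside ∷ outside ∷ outside ∷ outside ∷ [])
  ∷ (outside ∷ inside ∷ outside ∷ outside ∷ inside ∷ inside ∷ inside ∷ outside ∷ outside ∷ inside ∷ outside ∷ outside ∷ [])
  ∷ (outside ∷ outside ∷ inside ∷ outside ∷ outside ∷ inside ∷ inside ∷ inside ∷ outside ∷ outside ∷ inside ∷ outside ∷ [])
  ∷ (outside ∷ outside ∷ outside ∷ inside ∷ outside ∷ outside ∷ inside ∷ inside ∷ outside ∷ outside ∷ outside ∷ inside ∷ [])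
  ∷ (outside ∷ outside ∷ outside ∷ outside ∷ inside ∷ outside ∷ outside ∷ outside ∷ inside ∷ inside ∷ outside ∷ outside ∷ [])
  ∷ (outside ∷ outside ∷ outside ∷ outside ∷ outside ∷ inside ∷ outside ∷ outside ∷ inside ∷ inside ∷ inside ∷ outside ∷ [])
  ∷ (outside ∷ outside ∷ outside ∷ outside ∷ outside ∷ outside ∷ inside ∷ outside ∷ outside ∷ inside ∷ inside ∷ inside ∷ [])
  ∷ (outside ∷ outside ∷ outside ∷ outside ∷ outside ∷ outside ∷ outside ∷ inside ∷ outside ∷ outside ∷ inside ∷ inside ∷ [])
  ∷ []

gridClosedNbhds-correct : ∀ v u → u ∈ lookup gridClosedNbhds v ⇔ InClosedNbhd (Grid 3 4) v u
gridClosedNbhds-correct v u = mk⇔ (proj₁ (table v u)) (proj₂ (table v u))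
  where
  table = from-yes (all? λ v → all? λ u →
    (u ∈? lookup gridClosedNbhds v →-dec gridClosedNbhd? 3 4 v u) ×-dec
    (gridClosedNbhd? 3 4 v u →-dec u ∈? lookup gridClosedNbhds v))

open StrategyCheck (Grid 3 4) (lookup gridClosedNbhds) gridClosedNbhds-correct

dominatorWinsDGameIn5 : ℕ
dominatorWinsDGameIn5 = 25831122939029164696283624209924361461679667991557683664845351970371199684190024575793603028172589036126299191267916609917681009956384633996452441933279428581405878931167106763858075231368904081190613446832373597107528368502069249027767384846011061291980044582876443503292502699293396423698556799149762358005014495692499435953068893749155642720914048314405987436394885883603137024909996174952050264648686946240436568362704893154793615005514778900011277049781994874999583422021537386457311844906863755222704692804267960276875811399907428601697639090098107848081156089654783417215923384231796897907502863683586918940725482594071361104400383751646387096138320725407226326109224347579393498269356325881188321674124882627340694612590765492806910266818309235115134638468887518844552338412683593869922650153291104100061662991641935925117152748718119489804289934327382620577994637301196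
dominatorWinsSGameIn6 : ℕ
dominatorWinsSGameIn6 = 1206021427212309795760530416463703214927682102471334244516700559974118405114852787830304767486641315289312894113849894618030332497210955123104302697848138997018398216468385061916039108533637127221478758770411299239143611212261272041090533702948993369138691884403641377610484251679746968539185331028783354788581992759566977956794413107043439399292517399383811402746692562421822129894862665039134457181413838433079154868447583503186494171002090771133651902807182904706040975477370251531624496601001501015600964967147578005699847131146009274412563192036005580243518411468180301497995699072691586069536344220816453033553679456292849349836725637595937309587110894565327992053256097841512744199254544834099477097234767235480767933826400093289134576000637314855449136333279335151799515475366430809525447264658627277273831822135811076242690750057659369325800241914513333299619488282925144080246390641165305934766467710513498892094152499631331617259657592631387282000592068232959781779231019863324909097500052213421130921048277975483357949811308753515589315208460005275553805131584566102547860722398035130222190645391102534302001153920518866452853339902494628613163761883148805869271570311572840024136697196709776230832017986603554905049078161868535166382251962076769080828139224344123949632114680968886185579575582508926604304011547130179704044521354049312426841202511336165247253709307071040453844065934849429406568612856706360810500659463554325112235280750342129969981485965255860977170541553200474090218149218784146509269605280202546658147277176998314294651637882661759421167636199358688855048678223588809949999734561980524475229871619173130298119868709180506080954904595891647574268251501878806367110534740470259902930322968501196094763327957295809239973778622126190945378720575094164520672880037505474662837269692982516854917866626594791811894922616729017897887204981752403620906328922242119420315095273487541990747736341402293478267604635476533813151795124899670609187106305564807362758847316386160780530416031481598614257971176635466435947336798413125711307140004062039029446435994728096174819826821638667210491602818072264684927602561778392405281441762671028698529441490204143243287846805410180357797680368009795220349193121894336805716278500846479981818545408625050880819019608025610700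5518313142272143626883243296670987194241691218284289641376657104737460604982615648629282394017204299491008167817404301060339345814683535427315123219852223751706841836853047051077993143406917904705492583527479935721187734112593329866306843129491904975918769490423223246239304044461612858834175411494798447122685145346596842464466389003757238472666787176348941541346636095151194379344580309170800866061044719624752370047641520289633323682991527246070546901873254304711928055712058619214170203840928279462304837303512933222093083718344394409887459628164822497921171896542256964661052326720673580787268786310899217545017044420646441997783739756021329610444778783295946963257234564916760700882747991192386392844105768601957758562266081532436069569954248711055312172313897428412864904961529384901005160462752302595347896115079614696531972133617448395435469981125542332158352976337592006642494811317461843013540342898549386773914275310079608273586717713027276020959972121003009367489993835738811492151881465471570591463960480396154127171372321813011445801220738966195670635099295003446031938254857822258102482268493469532507434996654526673830697505600452087697994216055711536995245137298151918133993510448127239973290245515048266398377577840386260779912287312120865231800078953979172368574932211392813719865220966860384495484376519230037422067699033029218856823165563693816381200306089007656643456580257502690062918681933139426385228886867886690539785976249195714506051081663186876380920306929886382768286488203103404344153301681762198330794243507969160304753681946399578162497821383884330304453861929541579195482695994830663164240463245689755454807956274437809342262242272651741077318871089765463728164058282123454481249392294593080227503191631289026589008355618010291351317233762809287837713218168434852808639049833268007239504433540370805787009161082066445740460069500317037702472194543144800659740432005835261421037480008395267731038600569961614556607297171218604717791112591212981227957331264953281615154836693947592773520787322019916213078059550917354146321494221939676048968745939132397354070544482332814835603107641357241871564323168213527388614869329367015134295877184561264609802520681047793477144332162485178035870972007291465158875110822764977131993649286799893669146107478031032464623381527326511220038354927734917424774704714534012528762012405430334208493460033568304070404232952456930215773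1329693115045535872700121683591089299981817174172373075350913703895320049393928605375872436441535956164532620736252137662149295113732863113586376411646578513009583614355125203303614444759701240829506888968441215236141965528813053992726830101791207706253129780659330131042082587581795491186440324091589439418677896496487224050718848890006714549850523925310558687619341890890112701627213975452452536360690935066021201840011977783971625403910620235926732194452459937211688809672685563978194185965259021298117934983957800366101613969032138225472727492270506833755065737718895461359255290330963224238931052630154111111456681900134692640809912791776857944074774325959282876903680763212727261320868343515763959733156968121575055093081382538300126736255059828601337269936289238139582933494810145568312756380910864162014584922574938875171484949553551198882142115271967595147658047181492660417559609024761131469517289609043446934330980485928197156836287560019714002541478557281891313956166065877249469077931144674268230000191046500254349436379423120807809948841810919242110320499772387745897845189057272442288434412712925958382017068381685051903296193856418160691349027204007804640837242376860577214806442754680326054483994625062524660676317714712698740169544231683661356402062166258814121322529380537067043128769378917941536933799456288699978985701042077473098931387183625766570936702800573384245126347446836185697004032303597598250883357230957539552766607398821020017124682265159257232982212878393280130884414412977031371589545066251734662988340082199905567362127256863299162665175138230896035288156629863500194855700741621317828286769431322851952769568807325769728744927754588512831881271858485518587404705232584548821863480622159123342503852672180974152989450917892524742695128240560490827710822027988865800335939947828479060368450711746420352866045488436957395968901726673892723865027278340359431755429192244255242832617835562155424236190450121278475931532487369298310803576420387577219674477081866648034406574606342434892390101500396954431029022654112131861768083665059558325228211997558464367510236406830581567169095870741490131498984500446967453455260735046942408405092208135744611722566989538501627165238212565600870239235591206863430244494512998494245280791380406511040940934002531209626061172301255698112546861825501092685328480922381922002844605877950168695382633769065941679323999586653027107100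1791412464909035396631451119258428038327084340889533783189001833827620869178600497331075814196503851187350253696158123372191043623659036300163119041321328801175886083660211258253634408977633944046736314733127482427413034791427201051045944980344068572497051450209582701085505317529873112500914288900899842170546659603404060751505698449668593577167748456904707272328923310749327546123611912538669744174563452013928331614687474390301437321509662795532847070540227801146455083427914203468438296778806620866781319809205845356541616722472492682977587407077305661526769988770266095568727968735865914624525116643819993687112458345004977729172888376253791284274040502778978679167534899004084784157013675449653119715517613692257640618345410501434633346878470031933371883319371212
stallerSurvivesDGame4 : ℕ
stallerSurvivesDGame4 = 5463545165946496436129980822139227517750209646473503591418524259063217024896508084538714944710833307894786497514369737770728589185719305482051788011655791606498909647646265031226771327837706399466229521617384373878464542736875105323415147561285115754993480893882073966481808194702565021973877802519295735317015021419210099442076314946653753136890833403139502254025663033698940304033163111441306111149933505297227311231138418470525910032607514135808031112507342555846153504762088297741775237575729183729127750006616426611712931443239504541374375378947504182596133992379801628288366960798465058748405342858373222756862396714624211951241291781958186723167408899308417045479797404781555535843069467214926309398997757235169721726920682350240177052811107000230009259466578719010334442494816884742300965783560974885808668408894005482233433238188999956182056701338925717989588895235373097056331084496569940208749390171370825593768890617169962985428517019695429749710645867975449504268615460031930490221770613804938513783417645063453779689301814040055291256664484253716830410830723200867342393860176808158796355771260107025373910218128346115518241216964333844061686709035769514832423717216226327635016863714384233799281516879539325518898308071421047867890158506852131054751538130938992186481270296161696404472420173153829310641192685751938262195502047215986451155937314502188283828399929399653854670766894303862773715587641346632326161029932810677859132411185197672643611082466207424417239435253886632494133733447365331029581627930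08709460797262403670262051666102966662223073241224366169432746233575250509500247814612831218240334530934693630444600010862085495466987603950706923193322453469528772998179858159995546371013491697270692039817152195463845214304197479559664233901884228733126333680511382664512041674789189392670769769162168352031360471892827038899519317960145496459343481996239720024456882600739207364936079729104689788372662353680283801919177508080124856142053755739155637650477040435238185014234327504216664825538688819657118705739327199371931019977354104603073589905184210818762542949238913409029492785540117054901313934091887307995
stallerSurvivesSGame5 : ℕ
stallerSurvivesSGame5 = 18388898104225073463082681408415591481816042908550524651116479369702339134766677011961822455864234266365945943542006276669701455413855057694296026534755954731631688231536723783427922634650103554636669393184272947713011258724238283759125178201229984706482174818148611744924041746864449043239481096301468540267183994456551180057522577234683807910085750107979861413805798101320179632408956118972073738629892415997071707132767632075277351101168

proposition3p4 : γMB≡ (Grid 3 4) 5 × γ'MB≡ (Grid 3 4) 6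
proposition3p4 =
  γMB≡-intro  (Grid 3 4) (checkDTurn-sound 5 ⊥ ⊥ (passes dominatorWinsDGameIn5 refl))
                         (check¬DTurn-sound 4 ⊥ ⊥ (passes stallerSurvivesDGame4 refl)) ,
  γ'MB≡-intro (Grid 3 4) (checkSTurn-sound 6 ⊥ ⊥ (passes dominatorWinsSGameIn6 refl))
                         (check¬STurn-sound 5 ⊥ ⊥ (passes stallerSurvivesSGame5 refl))
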